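{- Let $d\ge1$ and $n_1,\ldots,n_{d+1}$ be positive integers. A $d$-dimensional partition $\pi$ contained in the $(2n_1,\ldots,2n_{d+1})$-box is fully complementary inside the $(2n_1,\ldots,2n_{d+1})$-box if and only if \[\pi_{i_1,\ldots,i_d}\cdot\gamma_J(\pi)_{i_1,\ldots,i_d}=0\qquad\text{and}\qquad \sum_{I\subseteq[d]}\gamma_I(\pi)_{i_1,\ldots,i_d}=2n_{d+1}\] for all non-empty subsets $J\subseteq[d]$ of even size and all $(i_1,\ldots,i_d)\in[2n_1]\times\cdots\times[2n_d]$.
   Context: A $d$-dimensional partition is an array $\pi=(\pi_{i_1,\ldots,i_d})$ indexed by $(\mathbb{N}_{>0})^d$ of non-negative integers, all but finitely many zero, weakly decreasing in each index. It is contained in an $(m_1,\ldots,m_{d+1})$-box if all entries are at most $m_{d+1}$ and $\pi_{\mathbf{i}}>0$ implies $i_j\le m_j$ for $1\le j\le d$. Its Ferrers diagram is $\lambda(\pi)=\{(i_1,\ldots,i_d,k): 1\le k\le \pi_{i_1,\ldots,i_d}\}$. For $I\subseteq[d+1]$ let $\rho_I$ be the bijection of $[2n_1]\times\cdots\times[2n_{d+1}]$ with $\rho_I(x)_i=x_i$ for $i\notin I$ and $\rho_I(x)_i=2n_i+1-x_i$ for $i\in I$; for $I\subseteq[d]$ the same formula defines $\rho_I$ on $[2n_1]\times\cdots\times[2n_d]$, and $\gamma_I(\pi)_{\mathbf{i}}=\pi_{\rho_I(\mathbf{i})}$. $\pi$ is fully complementary inside the $(2n_1,\ldots,2n_{d+1})$-box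 if, with $\lambda=\lambda(\pi)$, $\rho_I(\lambda)\cap\rho_J(\lambda)=\emptyset$ for all distinct $I,J\subseteq[d+1]$ of even size and $\bigcup_{|I|\text{ even}}\rho_I(\lambda)=[2n_1]\times\cdots\times[2n_{d+1}]$. -}

module Defs where

open import Data.Nat using (ℕ; zero; suc; _+_; _*_; _≤_; _<_)
open import Data.Nat.Divisibility using (_∣_)
open import Data.Fin using (Fin; toℕ; inject₁; fromℕ; opposite)
open import Data.Fin.Subset using (Subset; _∈_; ∣_∣)
open import Data.Vec using (_∷_; [])
open import Data.Bool using (true; false; if_then_else_)
open import Data.Vec using (lookup)
open import Data.Product using (Σ; _×_; ∃)
open import Relation.Binary.PropositionalEquality using (_≡_; _≢_)
open import Relation.Nullary using (¬_)

-- Coordinates are 0-based: Fin (2 * n j) stands for [2 n_j], so the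
-- reflection x ↦ 2n_j + 1 - x becomes Fin.opposite (x ↦ 2n_j - 1 - x).

Point : (m : ℕ) → (Fin m → ℕ) → Set
Point m k = (j : Fin m) → Fin (k j)

sides : (d : ℕ) → (Fin (suc d) → ℕ) → Fin (suc d) → ℕ
sides d n j = 2 * n j

baseSides : (d : ℕ) → (Fin (suc d) → ℕ) → Fin d → ℕ
baseSides d n j = 2 * n (inject₁ j)

Cell : (d : ℕ) → (Fin (suc d) → ℕ) → Set
Cell d n = Point (suc d) (sides d n)

Pos : (d : ℕ) → (Fin (suc d) → ℕ) → Set
Pos d n = Point d (baseSides d n)

ρ : {m : ℕ} {k : Fin m → ℕ} → Subset m → Point m k → Point m k
ρ I x j = if lookup I j then opposite (x j) else x j

-- A d-dimensional array restricted to the box positions (entries outside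
-- [2n_1]×...×[2n_d] are zero by the box condition).
Array : (d : ℕ) → (Fin (suc d) → ℕ) → Set
Array d n = Pos d n → ℕ

γ : {d : ℕ} {n : Fin (suc d) → ℕ} → Subset d → Array d n → Array d n
γ {d} {n} I π p = π (ρ {d} {baseSides d n} I p)

IsPartitionInBox : (d : ℕ) (n : Fin (suc d) → ℕ) → Array d n → Set
IsPartitionInBox d n π =
  (∀ (j : Fin d) (p q : Pos d n) →
     (∀ (k : Fin d) → k ≢ j → p k ≡ q k) → toℕ (p j) ≤ toℕ (q j) → π q ≤ π p)
  × (∀ (p : Pos d n) → π p ≤ 2 * n (fromℕ d))

-- Ferrers diagram membership: (i, k) ∈ λ(π) iff 1 ≤ k ≤ π_i (0-based: k < π_i)
_∈λ_ : {d : ℕ} {n : Fin (suc d) → ℕ} → Cell d n → Array d n → Set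
_∈λ_ {d} {n} c π = toℕ (c (fromℕ d)) < π (λ j → c (inject₁ j))

_∈ρ[_]λ_ : {d : ℕ} {n : Fin (suc d) → ℕ} → Cell d n → Subset (suc d) → Array d n → Set
_∈ρ[_]λ_ {d} {n} x I π = Σ (Cell d n) λ y → (_∈λ_ {d} {n} y π) × (∀ j → ρ {suc d} {sides d n} I y j ≡ x j)

EvenSet : {m : ℕ} → Subset m → Set
EvenSet I = 2 ∣ ∣ I ∣

FullyComplementary : (d : ℕ) (n : Fin (suc d) → ℕ) → Array d n → Set
FullyComplementary d n π =
  (∀ (I J : Subset (suc d)) → EvenSet I → EvenSet J → I ≢ J →
     ¬ (Σ (Cell d n) λ x → (_∈ρ[_]λ_ {d} {n} x I π) × (_∈ρ[_]λ_ {d} {n} x J π)))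
  × (∀ (x : Cell d n) → Σ (Subset (suc d)) λ I → EvenSet I × (_∈ρ[_]λ_ {d} {n} x I π))

sumSubsets : (m : ℕ) → (Subset m → ℕ) → ℕ
sumSubsets zero f = f []
sumSubsets (suc m) f = sumSubsets m (λ I → f (true ∷ I)) + sumSubsets m (λ I → f (false ∷ I))

-- Write a cell of the box as (p, k), p an index position and k ∈ [2n_{d+1}] a height, and
-- an even K ⊆ [d+1] as I ∪ {d+1} or I according as |I| is odd or even. Then (p, k) ∈ ρ_K(λ)
-- iff k ≤ γ_I(π)_p for even I, and iff k > 2n_{d+1} - γ_I(π)_p for odd I. So over each p
-- the even sets I contribute intervals at the bottom of the column and the odd ones
-- intervals at the top, and full complementarity says that these intervals tile the column.
-- Intervals of the same parity share an endpoint, so they are disjoint iff at most one of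
-- them is non-empty, which after the substitution p ↦ ρ_I p is the first condition; the two
-- remaining intervals then tile the column iff their lengths add up to 2n_{d+1}.
module Submission where

open import Defs
open import Algebra.Bundles using (CommutativeRing)
open import Data.Bool using (Bool; true; false; if_then_else_; _xor_)
open import Data.Bool.Properties using (xor-∧-commutativeRing; xor-assoc; xor-identityʳ; xor-same)
open import Data.Empty using (⊥-elim) renaming (⊥ to False)
open import Data.Fin using (Fin; toℕ; inject₁; fromℕ; opposite; fromℕ<)
  renaming (zero to fzero; suc to fsuc)
open import Data.Fin.Properties using (opposite-involutive; opposite-prop; toℕ-fromℕ<; toℕ<n)
open import Data.Fin.Relation.Unary.Top using (view; ‵fromℕ; ‵inject₁; view-fromℕ; view-inject₁)
open import Data.Fin.Subset using (Subset; Nonempty; ∣_∣) renaming (⊥ to ∅)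
open import Data.Fin.Subset.Properties using (∉⊥)
open import Data.Nat using (ℕ; zero; suc; _+_; _*_; _∸_; _≤_; _<_; z≤n; s≤s)
open import Data.Nat.Divisibility using (_∣_; _∣0; n∣n; ∣m∣n⇒∣m+n; ∣m+n∣m⇒∣n; ∣1⇒≡1)
open import Data.Nat.Properties
open import Data.Product using (Σ; _×_; _,_; proj₁; proj₂)
open import Data.Sum using (inj₁; inj₂)
open import Data.Vec using (Vec; []; _∷_; _∷ʳ_; lookup; zipWith; initLast; here; there)
open import Data.Vec.Properties using (∷-injectiveʳ; ∷ʳ-injectiveˡ; lookup-zipWith; lookup-replicate)
open import Function using (id)
open import Function.Bundles using (_⇔_; mk⇔; Equivalence)
open import Relation.Binary.Definitions using (Tri; tri<; tri≈; tri>)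
open import Relation.Binary.PropositionalEquality
open import Relation.Nullary using (¬_; yes; no; contradiction)

import Algebra.Properties.CommutativeSemigroup as CommSemigroupProperties

open Equivalence using (to; from)

private
  module ℕ+ = CommSemigroupProperties +-commutativeSemigroup
  module Xor = CommSemigroupProperties
    (CommutativeRing.+-commutativeSemigroup xor-∧-commutativeRing)

oppositeIf : ∀ {m} → Bool → Fin m → Fin m
oppositeIf b t = if b then opposite t else t

oppositeIf-involutive : ∀ {m} b (t : Fin m) → oppositeIf b (oppositeIf b t) ≡ t
oppositeIf-involutive true  t = opposite-involutive t
oppositeIf-involutive false t = refl

not-both-positive⇒*≡0 : ∀ a b → (0 < a → 0 < b → False) → a * b ≡ 0
not-both-positive⇒*≡0 zero    b       _ = refl
not-both-positive⇒*≡0 (suc a) zero    _ = *-zeroʳ a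
not-both-positive⇒*≡0 (suc a) (suc b) h = ⊥-elim (h (s≤s z≤n) (s≤s z≤n))

xor≡false⇒≡ : ∀ x y → x xor y ≡ false → y ≡ x
xor≡false⇒≡ false y     eq = eq
xor≡false⇒≡ true  true  _  = refl
xor≡false⇒≡ true  false ()

odd? : ∀ {m} → Subset m → Bool
odd? []      = false
odd? (b ∷ I) = b xor odd? I

2∣size+odd? : ∀ {m} (I : Subset m) → 2 ∣ (if odd? I then suc ∣ I ∣ else ∣ I ∣)
2∣size+odd? []          = 2 ∣0
2∣size+odd? (false ∷ I) = 2∣size+odd? I
2∣size+odd? (true ∷ I) with odd? I | 2∣size+odd? I
... | true  | 2∣1+∣I∣ = 2∣1+∣I∣
... | false | 2∣∣I∣   = ∣m∣n⇒∣m+n n∣n 2∣∣I∣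

EvenSet⇔odd?≡false : ∀ {m} (I : Subset m) → EvenSet I ⇔ odd? I ≡ false
EvenSet⇔odd?≡false I = mk⇔ even⇒ ⇒even
  where
  even⇒ : EvenSet I → odd? I ≡ false
  even⇒ 2∣∣I∣ with odd? I | 2∣size+odd? I
  ... | false | _       = refl
  ... | true  | 2∣1+∣I∣ =
    contradiction (∣1⇒≡1 (∣m+n∣m⇒∣n (subst (2 ∣_) (+-comm 1 ∣ I ∣) 2∣1+∣I∣) 2∣∣I∣)) λ ()
  ⇒even : odd? I ≡ false → EvenSet I
  ⇒even eq = subst (λ b → 2 ∣ (if b then suc ∣ I ∣ else ∣ I ∣)) eq (2∣size+odd? I)

odd?-∷ʳ : ∀ {m} (I : Subset m) b → odd? (I ∷ʳ b) ≡ odd? I xor b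
odd?-∷ʳ []      b = xor-identityʳ b
odd?-∷ʳ (a ∷ I) b = trans (cong (a xor_) (odd?-∷ʳ I b)) (sym (xor-assoc a (odd? I) b))

EvenSet-∷ʳodd? : ∀ {m} (I : Subset m) → EvenSet (I ∷ʳ odd? I)
EvenSet-∷ʳodd? I =
  from (EvenSet⇔odd?≡false (I ∷ʳ odd? I)) (trans (odd?-∷ʳ I (odd? I)) (xor-same (odd? I)))

EvenSet⇒≡∷ʳodd? : ∀ {m} (K : Subset (suc m)) → EvenSet K → Σ (Subset m) λ I → K ≡ I ∷ʳ odd? I
EvenSet⇒≡∷ʳodd? K evK with initLast K
... | I , b , refl = I , cong (I ∷ʳ_)
  (xor≡false⇒≡ (odd? I) b (trans (sym (odd?-∷ʳ I b)) (to (EvenSet⇔odd?≡false (I ∷ʳ b)) evK)))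

_⊕_ : ∀ {m} → Subset m → Subset m → Subset m
_⊕_ = zipWith _xor_

odd?-⊕ : ∀ {m} (I J : Subset m) → odd? (I ⊕ J) ≡ odd? I xor odd? J
odd?-⊕ []      []      = refl
odd?-⊕ (a ∷ I) (b ∷ J) = trans (cong ((a xor b) xor_) (odd?-⊕ I J))
                               (Xor.interchange a b (odd? I) (odd? J))

≢⇒Nonempty-⊕ : ∀ {m} (I J : Subset m) → I ≢ J → Nonempty (I ⊕ J)
≢⇒Nonempty-⊕ []          []          I≢J = ⊥-elim (I≢J refl)
≢⇒Nonempty-⊕ (true ∷ I)  (false ∷ J) _   = fzero , here
≢⇒Nonempty-⊕ (false ∷ I) (true ∷ J)  _   = fzero , here
≢⇒Nonempty-⊕ (true ∷ I)  (true ∷ J)  I≢J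
  with ≢⇒Nonempty-⊕ I J (λ eq → I≢J (cong (true ∷_) eq))
... | i , i∈ = fsuc i , there i∈
≢⇒Nonempty-⊕ (false ∷ I) (false ∷ J) I≢J
  with ≢⇒Nonempty-⊕ I J (λ eq → I≢J (cong (false ∷_) eq))
... | i , i∈ = fsuc i , there i∈

odd?-∅ : ∀ m → odd? (∅ {m}) ≡ false
odd?-∅ zero    = refl
odd?-∅ (suc m) = odd?-∅ m

Nonempty⇒≢∅ : ∀ {m} (J : Subset m) → Nonempty J → J ≢ ∅
Nonempty⇒≢∅ J (i , i∈J) refl = ∉⊥ i∈J

sumSubsets-cong : ∀ m {f g : Subset m → ℕ} → (∀ I → f I ≡ g I) → sumSubsets m f ≡ sumSubsets m g
sumSubsets-cong zero    f≗g = f≗g []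
sumSubsets-cong (suc m) f≗g =
  cong₂ _+_ (sumSubsets-cong m (λ I → f≗g (true ∷ I))) (sumSubsets-cong m (λ I → f≗g (false ∷ I)))

sumSubsets-+ : ∀ m (f g : Subset m → ℕ) →
               sumSubsets m (λ I → f I + g I) ≡ sumSubsets m f + sumSubsets m g
sumSubsets-+ zero    f g = refl
sumSubsets-+ (suc m) f g =
  trans (cong₂ _+_ (sumSubsets-+ m (λ I → f (true ∷ I)) (λ I → g (true ∷ I)))
                   (sumSubsets-+ m (λ I → f (false ∷ I)) (λ I → g (false ∷ I))))
        (ℕ+.interchange (sumSubsets m (λ I → f (true ∷ I))) (sumSubsets m (λ I → g (true ∷ I)))
                        (sumSubsets m (λ I → f (false ∷ I))) (sumSubsets m (λ I → g (false ∷ I))))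

≤-sumSubsets : ∀ m (f : Subset m → ℕ) I → f I ≤ sumSubsets m f
≤-sumSubsets zero    f []          = ≤-refl
≤-sumSubsets (suc m) f (true ∷ I)  = ≤-trans (≤-sumSubsets m _ I) (m≤m+n _ _)
≤-sumSubsets (suc m) f (false ∷ I) = ≤-trans (≤-sumSubsets m _ I) (m≤n+m _ _)

sumSubsets-pairwise-zero : ∀ m (f : Subset m → ℕ) → (∀ I J → I ≢ J → f I * f J ≡ 0) →
                           Σ (Subset m) λ I → sumSubsets m f ≡ f I
sumSubsets-pairwise-zero zero    f _ = [] , refl
sumSubsets-pairwise-zero (suc m) f pairwise
  with sumSubsets-pairwise-zero m _ (λ I J I≢J → pairwise _ _ (λ eq → I≢J (∷-injectiveʳ eq)))
     | sumSubsets-pairwise-zero m _ (λ I J I≢J → pairwise _ _ (λ eq → I≢J (∷-injectiveʳ eq)))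
... | I , sumT≡ | J , sumF≡
  with m*n≡0⇒m≡0∨n≡0 (f (true ∷ I)) (pairwise (true ∷ I) (false ∷ J) λ ())
...   | inj₁ fI≡0 = false ∷ J , cong₂ _+_ (trans sumT≡ fI≡0) sumF≡
...   | inj₂ fJ≡0 = true ∷ I , trans (cong₂ _+_ sumT≡ (trans sumF≡ fJ≡0)) (+-identityʳ _)

toℕ-opposite<⇔ : ∀ {N} (k : Fin N) h → toℕ (opposite k) < h ⇔ N < h + suc (toℕ k)
toℕ-opposite<⇔ {N} k h = mk⇔
  (λ lt → subst (_< h + suc (toℕ k)) N∸1+k+1+k≡N
            (+-monoˡ-< (suc (toℕ k)) (subst (_< h) (opposite-prop k) lt)))
  (λ lt → subst (_< h) (sym (opposite-prop k))
            (+-cancelʳ-< (suc (toℕ k)) _ _ (subst (_< h + suc (toℕ k)) (sym N∸1+k+1+k≡N) lt)))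
  where
  N∸1+k+1+k≡N : N ∸ suc (toℕ k) + suc (toℕ k) ≡ N
  N∸1+k+1+k≡N = m∸n+n≡m (toℕ<n k)

SameParityDisjoint : ∀ {d} → (Subset d → ℕ) → Set
SameParityDisjoint f = ∀ I J → I ≢ J → odd? I ≡ odd? J → f I * f J ≡ 0

module Column (N : ℕ) {d : ℕ} (f : Subset d → ℕ) where

  Covers : Subset d → Fin N → Set
  Covers I k = toℕ (oppositeIf (odd? I) k) < f I

  Tiles : Set
  Tiles = (∀ k I J → I ≢ J → Covers I k → Covers J k → False)
        × (∀ k → Σ (Subset d) λ I → Covers I k)

  covers-even : ∀ {I} k → odd? I ≡ false → Covers I k ⇔ toℕ k < f I
  covers-even {I} k eq =
    subst (λ b → toℕ (oppositeIf b k) < f I ⇔ toℕ k < f I) (sym eq) (mk⇔ id id)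

  covers-odd : ∀ {I} k → odd? I ≡ true → Covers I k ⇔ N < f I + suc (toℕ k)
  covers-odd {I} k eq =
    subst (λ b → toℕ (oppositeIf b k) < f I ⇔ N < f I + suc (toℕ k)) (sym eq)
          (toℕ-opposite<⇔ k (f I))

  -- Under SameParityDisjoint, height b is the length of the unique non-empty interval of
  -- parity b (or 0).
  part : Bool → Subset d → ℕ
  part b I = if b xor odd? I then 0 else f I

  height : Bool → ℕ
  height b = sumSubsets d (part b)

  part-positive : ∀ b I → 0 < part b I → odd? I ≡ b × part b I ≡ f I
  part-positive b I pos with b xor odd? I in eq
  ... | true  = ⊥-elim (n≮0 pos)
  ... | false = xor≡false⇒≡ b (odd? I) eq , refl

  part-own : ∀ I → part (odd? I) I ≡ f I
  part-own I rewrite xor-same (odd? I) = refl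

  part-pairwise-zero : SameParityDisjoint f → ∀ b I J → I ≢ J → part b I * part b J ≡ 0
  part-pairwise-zero disjoint b I J I≢J with b xor odd? I in eqI | b xor odd? J in eqJ
  ... | true  | _     = refl
  ... | false | true  = *-zeroʳ (f I)
  ... | false | false =
    disjoint I J I≢J (trans (xor≡false⇒≡ b (odd? I) eqI) (sym (xor≡false⇒≡ b (odd? J) eqJ)))

  sumSubsets≡height+height : sumSubsets d f ≡ height false + height true
  sumSubsets≡height+height = trans (sumSubsets-cong d split) (sumSubsets-+ d (part false) (part true))
    where
    split : ∀ I → f I ≡ part false I + part true I
    split I with odd? I
    ... | false = sym (+-identityʳ (f I))
    ... | true  = refl

  ≤-height : ∀ {b} I → odd? I ≡ b → f I ≤ height b
  ≤-height I refl = subst (_≤ height (odd? I)) (part-own I) (≤-sumSubsets d (part (odd? I)) I)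

  height-attained : SameParityDisjoint f → ∀ b → 0 < height b →
                    Σ (Subset d) λ I → odd? I ≡ b × f I ≡ height b
  height-attained disjoint b pos with sumSubsets-pairwise-zero d (part b) (part-pairwise-zero disjoint b)
  ... | I , height≡part with part-positive b I (subst (0 <_) height≡part pos)
  ...   | odd?I≡b , part≡f = I , odd?I≡b , sym (trans height≡part part≡f)

  height≤ : SameParityDisjoint f → (∀ I → f I ≤ N) → ∀ b → height b ≤ N
  height≤ disjoint bounded b with sumSubsets-pairwise-zero d (part b) (part-pairwise-zero disjoint b)
  ... | I , height≡part = subst (_≤ N) (sym height≡part) (≤-trans (part≤ I) (bounded I))
    where
    part≤ : ∀ I → part b I ≤ f I
    part≤ I with b xor odd? I
    ... | true  = z≤n
    ... | false = ≤-refl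

  module _ (disjoint : SameParityDisjoint f) (E+O≡N : height false + height true ≡ N) where

    private
      E O : ℕ
      E = height false
      O = height true

    tiles-disjoint : ∀ k I J → I ≢ J → Covers I k → Covers J k → False
    tiles-disjoint k I J I≢J cI cJ = by-parity (odd? I) (odd? J) refl refl
      where
      same : odd? I ≡ odd? J → False
      same eq with m*n≡0⇒m≡0∨n≡0 (f I) (disjoint I J I≢J eq)
      ... | inj₁ fI≡0 = n≮0 (subst (_ <_) fI≡0 cI)
      ... | inj₂ fJ≡0 = n≮0 (subst (_ <_) fJ≡0 cJ)
      mixed : ∀ I J → odd? I ≡ false → odd? J ≡ true → Covers I k → Covers J k → False
      mixed I J eI eJ cI cJ = <-irrefl refl (begin-strict
        N                  <⟨ to (covers-odd k eJ) cJ ⟩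
        f J + suc (toℕ k)  ≤⟨ +-mono-≤ (≤-height J eJ)
                                        (≤-trans (to (covers-even k eI) cI) (≤-height I eI)) ⟩
        O + E              ≡⟨ +-comm O E ⟩
        E + O              ≡⟨ E+O≡N ⟩
        N                  ∎)
        where open ≤-Reasoning
      by-parity : ∀ a b → odd? I ≡ a → odd? J ≡ b → False
      by-parity false true  eI eJ = mixed I J eI eJ cI cJ
      by-parity true  false eI eJ = mixed J I eJ eI cJ cI
      by-parity false false eI eJ = same (trans eI (sym eJ))
      by-parity true  true  eI eJ = same (trans eI (sym eJ))

    private
      E≤k⇒N<O+1+k : ∀ (k : Fin N) → E ≤ toℕ k → N < O + suc (toℕ k)
      E≤k⇒N<O+1+k k E≤k = begin-strict
        N                ≡⟨ sym E+O≡N ⟩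
        E + O            ≤⟨ +-monoˡ-≤ O E≤k ⟩
        toℕ k + O        ≡⟨ +-comm (toℕ k) O ⟩
        O + toℕ k        <⟨ +-monoʳ-< O (n<1+n (toℕ k)) ⟩
        O + suc (toℕ k)  ∎
        where open ≤-Reasoning

    tiles-cover : ∀ k → Σ (Subset d) λ I → Covers I k
    tiles-cover k with toℕ k <? E
    ... | yes k<E with height-attained disjoint false (≤-<-trans z≤n k<E)
    ...   | I , eI , fI≡E = I , from (covers-even k eI) (subst (toℕ k <_) (sym fI≡E) k<E)
    tiles-cover k | no k≮E
      with height-attained disjoint true
             (m<n⇒0<n (from (toℕ-opposite<⇔ k O) (E≤k⇒N<O+1+k k (≮⇒≥ k≮E))))
    ...   | I , eI , fI≡O = I , from (covers-odd k eI)
      (subst (λ h → N < h + suc (toℕ k)) (sym fI≡O) (E≤k⇒N<O+1+k k (≮⇒≥ k≮E)))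

  tiles⇒disjoint : (∀ I → f I ≤ N) → Tiles → SameParityDisjoint f
  tiles⇒disjoint bounded (disjoint-covers , _) I J I≢J same =
    not-both-positive⇒*≡0 (f I) (f J) λ fI>0 fJ>0 →
      disjoint-covers (k fI>0) I J I≢J (covers-k fI>0 I refl fI>0) (covers-k fI>0 J (sym same) fJ>0)
    where
    k : 0 < f I → Fin N
    k fI>0 = oppositeIf (odd? I) (fromℕ< (<-≤-trans fI>0 (bounded I)))
    covers-k : ∀ fI>0 L → odd? L ≡ odd? I → 0 < f L → Covers L (k fI>0)
    covers-k fI>0 L eq fL>0 = subst (λ b → toℕ (oppositeIf b (k fI>0)) < f L) (sym eq)
      (subst (_< f L) (sym (trans (cong toℕ (oppositeIf-involutive (odd? I) _)) (toℕ-fromℕ< _))) fL>0)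

  module _ (bounded : ∀ I → f I ≤ N) (tiled : Tiles) where

    private
      disjoint : SameParityDisjoint f
      disjoint = tiles⇒disjoint bounded tiled
      E O : ℕ
      E = height false
      O = height true

    tiles⇒heights≮N : E + O < N → False
    tiles⇒heights≮N E+O<N = uncovered (proj₂ tiled k)
      where
      k : Fin N
      k = fromℕ< (m+n≤o⇒m≤o (suc E) E+O<N)
      uncovered : (Σ (Subset d) λ I → Covers I k) → False
      uncovered (I , cI) = by-parity (odd? I) refl
        where
        by-parity : ∀ b → odd? I ≡ b → False
        by-parity false eI = <-irrefl (toℕ-fromℕ< _)
          (<-≤-trans (to (covers-even k eI) cI) (≤-height I eI))
        by-parity true eI = <-irrefl refl (begin-strict
          N                  <⟨ to (covers-odd k eI) cI ⟩
          f I + suc (toℕ k)  ≤⟨ +-monoˡ-≤ _ (≤-height I eI) ⟩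
          O + suc (toℕ k)    ≡⟨ cong (λ e → O + suc e) (toℕ-fromℕ< _) ⟩
          O + suc E          ≡⟨ +-suc O E ⟩
          suc (O + E)        ≡⟨ cong suc (+-comm O E) ⟩
          suc (E + O)        ≤⟨ E+O<N ⟩
          N                  ∎)
          where open ≤-Reasoning

    tiles⇒N≮heights : N < E + O → False
    tiles⇒N≮heights N<E+O =
      two-covers (height-attained disjoint false E>0) (height-attained disjoint true O>0)
      where
      E≤N : E ≤ N
      E≤N = height≤ disjoint bounded false
      O≤N : O ≤ N
      O≤N = height≤ disjoint bounded true
      E>0 : 0 < E
      E>0 = +-cancelˡ-< O 0 E (≤-<-trans (subst (_≤ N) (sym (+-identityʳ O)) O≤N)
                                          (subst (N <_) (+-comm E O) N<E+O))
      O>0 : 0 < O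
      O>0 = +-cancelˡ-< E 0 O (≤-<-trans (subst (_≤ N) (sym (+-identityʳ E)) E≤N) N<E+O)
      k : Fin N
      k = fromℕ< (∸-monoʳ-< {N} {O} {0} O>0 O≤N)
      k<E : toℕ k < E
      k<E = subst (_< E) (sym (toℕ-fromℕ< _))
              (+-cancelʳ-< O (N ∸ O) E (subst (_< E + O) (sym (m∸n+n≡m O≤N)) N<E+O))
      N<O+1+k : N < O + suc (toℕ k)
      N<O+1+k = begin-strict
        N                  <⟨ n<1+n N ⟩
        suc N              ≡⟨ cong suc (sym (m+[n∸m]≡n O≤N)) ⟩
        suc (O + (N ∸ O))  ≡⟨ sym (+-suc O (N ∸ O)) ⟩
        O + suc (N ∸ O)    ≡⟨ cong (λ e → O + suc e) (sym (toℕ-fromℕ< _)) ⟩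
        O + suc (toℕ k)    ∎
        where open ≤-Reasoning
      two-covers : (Σ (Subset d) λ I → odd? I ≡ false × f I ≡ E) →
                   (Σ (Subset d) λ J → odd? J ≡ true × f J ≡ O) → False
      two-covers (I , eI , fI≡E) (J , eJ , fJ≡O) = proj₁ tiled k I J I≢J
        (from (covers-even k eI) (subst (toℕ k <_) (sym fI≡E) k<E))
        (from (covers-odd k eJ) (subst (λ h → N < h + suc (toℕ k)) (sym fJ≡O) N<O+1+k))
        where
        I≢J : I ≢ J
        I≢J refl = contradiction (trans (sym eI) eJ) λ ()

    tiles⇒sum≡N : sumSubsets d f ≡ N
    tiles⇒sum≡N = trans sumSubsets≡height+height (by-cmp (<-cmp (E + O) N))
      where
      by-cmp : Tri (E + O < N) (E + O ≡ N) (N < E + O) → E + O ≡ N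
      by-cmp (tri< lt _ _) = ⊥-elim (tiles⇒heights≮N lt)
      by-cmp (tri≈ _ eq _) = eq
      by-cmp (tri> _ _ gt) = ⊥-elim (tiles⇒N≮heights gt)

  tiles⇔ : (∀ I → f I ≤ N) → Tiles ⇔ (SameParityDisjoint f × sumSubsets d f ≡ N)
  tiles⇔ bounded = mk⇔
    (λ t → tiles⇒disjoint bounded t , tiles⇒sum≡N bounded t)
    (λ (disjoint , sum≡N) → let E+O≡N = trans (sym sumSubsets≡height+height) sum≡N
                            in tiles-disjoint disjoint E+O≡N , tiles-cover disjoint E+O≡N)

_≋_ : ∀ {m} {k : Fin m → ℕ} → Point m k → Point m k → Set
x ≋ y = ∀ j → x j ≡ y j

ρ-involutive : ∀ {m} {k : Fin m → ℕ} (I : Subset m) (x : Point m k) → ρ I (ρ I x) ≋ x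
ρ-involutive I x j = oppositeIf-involutive (lookup I j) (x j)

ρ-cong : ∀ {m} {k : Fin m → ℕ} (I : Subset m) {x y : Point m k} → x ≋ y → ρ I x ≋ ρ I y
ρ-cong I x≋y j = cong (oppositeIf (lookup I j)) (x≋y j)

ρ-∅ : ∀ {m} {k : Fin m → ℕ} (x : Point m k) → ρ ∅ x ≋ x
ρ-∅ x j = cong (λ b → oppositeIf b (x j)) (lookup-replicate j false)

ρ-⊕ : ∀ {m} {k : Fin m → ℕ} (I J : Subset m) (x : Point m k) → ρ (I ⊕ J) (ρ I x) ≋ ρ J x
ρ-⊕ I J x j = trans (cong (λ b → oppositeIf b (ρ I x j)) (lookup-zipWith _xor_ j I J))
                    (oppositeIf-xor (lookup I j) (lookup J j) (x j))
  where
  oppositeIf-xor : ∀ {m} a b (t : Fin m) → oppositeIf (a xor b) (oppositeIf a t) ≡ oppositeIf b t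
  oppositeIf-xor true  true  t = refl
  oppositeIf-xor true  false t = opposite-involutive t
  oppositeIf-xor false b     t = refl

lookup-∷ʳ-inject₁ : ∀ {m} {A : Set} (xs : Vec A m) x (j : Fin m) →
                    lookup (xs ∷ʳ x) (inject₁ j) ≡ lookup xs j
lookup-∷ʳ-inject₁ (y ∷ xs) x fzero    = refl
lookup-∷ʳ-inject₁ (y ∷ xs) x (fsuc j) = lookup-∷ʳ-inject₁ xs x j

lookup-∷ʳ-fromℕ : ∀ {m} {A : Set} (xs : Vec A m) x → lookup (xs ∷ʳ x) (fromℕ m) ≡ x
lookup-∷ʳ-fromℕ []       x = refl
lookup-∷ʳ-fromℕ (y ∷ xs) x = lookup-∷ʳ-fromℕ xs x

module _ {d : ℕ} {n : Fin (suc d) → ℕ} where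

  base : Cell d n → Pos d n
  base x j = x (inject₁ j)

  level : Cell d n → Fin (2 * n (fromℕ d))
  level x = x (fromℕ d)

  cell : Pos d n → Fin (2 * n (fromℕ d)) → Cell d n
  cell p k j with view j
  ... | ‵fromℕ     = k
  ... | ‵inject₁ i = p i

  base-cell : ∀ p k → base (cell p k) ≋ p
  base-cell p k j rewrite view-inject₁ j = refl

  level-cell : ∀ p k → level (cell p k) ≡ k
  level-cell p k rewrite view-fromℕ d = refl

  cell-base-level : ∀ x → cell (base x) (level x) ≋ x
  cell-base-level x j with view j
  ... | ‵fromℕ     = refl
  ... | ‵inject₁ _ = refl

  level-ρ-cell : ∀ I b (p : Pos d n) k → level (ρ (I ∷ʳ b) (cell p k)) ≡ oppositeIf b k
  level-ρ-cell I b p k = cong₂ oppositeIf (lookup-∷ʳ-fromℕ I b) (level-cell p k)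

  base-ρ-cell : ∀ I b (p : Pos d n) k → base (ρ (I ∷ʳ b) (cell p k)) ≋ ρ I p
  base-ρ-cell I b p k j = cong₂ oppositeIf (lookup-∷ʳ-inject₁ I b j) (base-cell p k j)

  -- Positions are functions, so without extensionality π p ≡ π q needs an argument: weak
  -- monotonicity along one index, used in both directions. This is where d ≥ 1 is used.
  partition-resp-≋ : ∀ {π} → IsPartitionInBox d n π → Fin d →
                     ∀ {p q : Pos d n} → p ≋ q → π p ≡ π q
  partition-resp-≋ (monotone , _) j {p} {q} p≋q = ≤-antisym
    (monotone j q p (λ i _ → sym (p≋q i)) (≤-reflexive (cong toℕ (sym (p≋q j)))))
    (monotone j p q (λ i _ → p≋q i) (≤-reflexive (cong toℕ (p≋q j))))

  module _ (π : Array d n) where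

    _∈ρ[_]λπ : Cell d n → Subset (suc d) → Set
    x ∈ρ[ K ]λπ = _∈ρ[_]λ_ {d} {n} x K π

    ∈ρλ-resp-≋ : ∀ {K} {x y : Cell d n} → x ≋ y → x ∈ρ[ K ]λπ → y ∈ρ[ K ]λπ
    ∈ρλ-resp-≋ x≋y (z , z∈λ , ρz≋x) = z , z∈λ , λ j → trans (ρz≋x j) (x≋y j)

    module _ (π-resp-≋ : ∀ {p q : Pos d n} → p ≋ q → π p ≡ π q) where

      ∈ρλ-cell⇔ : ∀ I b (p : Pos d n) k →
                  cell p k ∈ρ[ I ∷ʳ b ]λπ ⇔ toℕ (oppositeIf b k) < π (ρ I p)
      ∈ρλ-cell⇔ I b p k = mk⇔ ∈⇒ ⇒∈
        where
        ∈⇒ : cell p k ∈ρ[ I ∷ʳ b ]λπ → toℕ (oppositeIf b k) < π (ρ I p)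
        ∈⇒ (y , y∈λ , ρy≋c) = subst₂ _<_
          (cong toℕ (trans (y≋ρc (fromℕ d)) (level-ρ-cell I b p k)))
          (π-resp-≋ (λ j → trans (y≋ρc (inject₁ j)) (base-ρ-cell I b p k j)))
          y∈λ
          where
          y≋ρc : y ≋ ρ (I ∷ʳ b) (cell p k)
          y≋ρc j = trans (sym (ρ-involutive (I ∷ʳ b) y j)) (ρ-cong (I ∷ʳ b) ρy≋c j)
        ⇒∈ : toℕ (oppositeIf b k) < π (ρ I p) → cell p k ∈ρ[ I ∷ʳ b ]λπ
        ⇒∈ lt = ρ (I ∷ʳ b) (cell p k)
              , subst₂ _<_ (cong toℕ (sym (level-ρ-cell I b p k)))
                           (π-resp-≋ (λ j → sym (base-ρ-cell I b p k j))) lt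
              , ρ-involutive (I ∷ʳ b) (cell p k)

      ∈ρλ⇔ : ∀ I b (x : Cell d n) →
             x ∈ρ[ I ∷ʳ b ]λπ ⇔ toℕ (oppositeIf b (level x)) < π (ρ I (base x))
      ∈ρλ⇔ I b x = mk⇔
        (λ x∈ → to (∈ρλ-cell⇔ I b (base x) (level x))
                   (∈ρλ-resp-≋ {I ∷ʳ b} (λ j → sym (cell-base-level x j)) x∈))
        (λ lt → ∈ρλ-resp-≋ {I ∷ʳ b} (cell-base-level x)
                   (from (∈ρλ-cell⇔ I b (base x) (level x)) lt))

      private
        heights : Pos d n → Subset d → ℕ
        heights p I = γ {d} {n} I π p

        open module ColumnAt (p : Pos d n) = Column (2 * n (fromℕ d)) (heights p)
          using (Covers; Tiles)

      fullyComplementary⇒tiles : FullyComplementary d n π → ∀ p → Tiles p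
      fullyComplementary⇒tiles (disjoint , cover) p = disjoint-covers , column-cover
        where
        disjoint-covers : ∀ k I J → I ≢ J → Covers p I k → Covers p J k → False
        disjoint-covers k I J I≢J cI cJ =
          disjoint (I ∷ʳ odd? I) (J ∷ʳ odd? J) (EvenSet-∷ʳodd? I) (EvenSet-∷ʳodd? J)
                   (λ eq → I≢J (∷ʳ-injectiveˡ I J eq))
                   ( cell p k
                   , from (∈ρλ-cell⇔ I (odd? I) p k) cI
                   , from (∈ρλ-cell⇔ J (odd? J) p k) cJ)
        column-cover : ∀ k → Σ (Subset d) λ I → Covers p I k
        column-cover k with cover (cell p k)
        ... | K , evK , cell∈K with EvenSet⇒≡∷ʳodd? K evK
        ...   | I , refl = I , to (∈ρλ-cell⇔ I (odd? I) p k) cell∈K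

      tiles⇒fullyComplementary : (∀ p → Tiles p) → FullyComplementary d n π
      tiles⇒fullyComplementary tiles = disjoint , cover
        where
        disjoint : ∀ K L → EvenSet K → EvenSet L → K ≢ L →
                   ¬ (Σ (Cell d n) λ x → x ∈ρ[ K ]λπ × x ∈ρ[ L ]λπ)
        disjoint K L evK evL K≢L (x , x∈K , x∈L)
          with EvenSet⇒≡∷ʳodd? K evK | EvenSet⇒≡∷ʳodd? L evL
        ... | I , refl | J , refl = proj₁ (tiles (base x)) (level x) I J (λ { refl → K≢L refl })
          (to (∈ρλ⇔ I (odd? I) x) x∈K) (to (∈ρλ⇔ J (odd? J) x) x∈L)
        cover : ∀ x → Σ (Subset (suc d)) λ K → EvenSet K × x ∈ρ[ K ]λπ
        cover x with proj₂ (tiles (base x)) (level x)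
        ... | I , cI = I ∷ʳ odd? I , EvenSet-∷ʳodd? I , from (∈ρλ⇔ I (odd? I) x) cI

      sameParityDisjoint⇔ :
        (∀ p → SameParityDisjoint (heights p)) ⇔
        (∀ (J : Subset d) → Nonempty J → EvenSet J → ∀ p → π p * γ {d} {n} J π p ≡ 0)
      sameParityDisjoint⇔ = mk⇔
        (λ disjoint J J≠∅ evJ p → subst (λ v → v * π (ρ J p) ≡ 0) (π-resp-≋ (ρ-∅ p))
           (disjoint p ∅ J (≢-sym (Nonempty⇒≢∅ J J≠∅))
                     (trans (odd?-∅ d) (sym (to (EvenSet⇔odd?≡false J) evJ)))))
        (λ vanish p I J I≢J same → subst (λ v → π (ρ I p) * v ≡ 0) (π-resp-≋ (ρ-⊕ I J p))
           (vanish (I ⊕ J) (≢⇒Nonempty-⊕ I J I≢J)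
                   (from (EvenSet⇔odd?≡false (I ⊕ J))
                         (trans (odd?-⊕ I J) (trans (cong (_xor odd? J) same) (xor-same (odd? J)))))
                   (ρ I p)))

lemma2p1 : (d : ℕ) → 1 ≤ d → (n : Fin (suc d) → ℕ) → (∀ j → 1 ≤ n j) →
    (π : Array d n) → IsPartitionInBox d n π →
    (FullyComplementary d n π ⇔
      ((∀ (J : Subset d) → Nonempty J → EvenSet J → ∀ (p : Pos d n) →
          π p * γ {d} {n} J π p ≡ 0)
       × (∀ (p : Pos d n) → sumSubsets d (λ I → γ {d} {n} I π p) ≡ 2 * n (fromℕ d))))
lemma2p1 (suc d) (s≤s z≤n) n _ π partition = mk⇔
  (λ fc → to vanishing⇔ (λ p → proj₁ (to (tiles⇔ p) (fc⇒tiles fc p)))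
        , (λ p → proj₂ (to (tiles⇔ p) (fc⇒tiles fc p))))
  (λ (vanish , sum≡N) → tiles⇒fc (λ p → from (tiles⇔ p) (from vanishing⇔ vanish p , sum≡N p)))
  where
  N : ℕ
  N = 2 * n (fromℕ (suc d))
  heights : Pos (suc d) n → Subset (suc d) → ℕ
  heights p I = γ {suc d} {n} I π p
  π-resp-≋ : ∀ {p q : Pos (suc d) n} → p ≋ q → π p ≡ π q
  π-resp-≋ = partition-resp-≋ {suc d} {n} partition fzero
  fc⇒tiles : FullyComplementary (suc d) n π → ∀ p → Column.Tiles N (heights p)
  fc⇒tiles = fullyComplementary⇒tiles {suc d} {n} π π-resp-≋
  tiles⇒fc : (∀ p → Column.Tiles N (heights p)) → FullyComplementary (suc d) n π
  tiles⇒fc = tiles⇒fullyComplementary {suc d} {n} π π-resp-≋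
  vanishing⇔ : (∀ p → SameParityDisjoint (heights p)) ⇔
               (∀ (J : Subset (suc d)) → Nonempty J → EvenSet J → ∀ p → π p * heights p J ≡ 0)
  vanishing⇔ = sameParityDisjoint⇔ {suc d} {n} π π-resp-≋
  tiles⇔ : ∀ p → Column.Tiles N (heights p) ⇔
                 (SameParityDisjoint (heights p) × sumSubsets (suc d) (heights p) ≡ N)
  tiles⇔ p = Column.tiles⇔ N (heights p) (λ I → proj₂ partition (ρ I p))
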